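{- Let $q\ge1$ and $b$ be integers with $\gcd(b,q)=1$. Then for every $f\in\mathbb{N}$ we have $s(q;fb)\asymp_f s(q;b)$, with implied constants depending only on $f$. Moreover, if $\overline{b}$ denotes the inverse of $b$ modulo $q$, then $s(q;b)=s(q;\overline{b})$.
   Context: For integers $q\ge1$, $b$, $\Lambda_{q,b}=\{(n_1,n_2)\in\mathbb{Z}^2\colon n_1+bn_2\equiv0\bmod q\}$ and $s(q;b)$ is the Euclidean length of a shortest nonzero vector of $\Lambda_{q,b}$. -}

module Defs where

open import Data.Nat using (ℕ; _≤_) renaming (_+_ to _+ℕ_; _*_ to _*ℕ_)
open import Data.Integer using (ℤ; +_; _+_; _*_; ∣_∣; 0ℤ)
open import Data.Integer.Divisibility using (_∣_)
open import Data.Product using (_×_; Σ)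
open import Relation.Binary.PropositionalEquality using (_≡_)
open import Relation.Nullary using (¬_)

InΛ : ℕ → ℤ → ℤ → ℤ → Set
InΛ q b n₁ n₂ = (+ q) ∣ (n₁ + b * n₂)

NonZeroVec : ℤ → ℤ → Set
NonZeroVec n₁ n₂ = ¬ (n₁ ≡ 0ℤ × n₂ ≡ 0ℤ)

normSq : ℤ → ℤ → ℕ
normSq n₁ n₂ = ∣ n₁ ∣ *ℕ ∣ n₁ ∣ +ℕ ∣ n₂ ∣ *ℕ ∣ n₂ ∣

-- "m = s(q;b)²": m is the squared length of a shortest nonzero vector of Λ_{q,b},
-- i.e. it is attained by a nonzero lattice vector and bounds from below all of them.
IsShortestSq : ℕ → ℤ → ℕ → Set
IsShortestSq q b m =
  Σ ℤ (λ n₁ → Σ ℤ (λ n₂ → InΛ q b n₁ n₂ × NonZeroVec n₁ n₂ × normSq n₁ n₂ ≡ m))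
  × (∀ n₁ n₂ → InΛ q b n₁ n₂ → NonZeroVec n₁ n₂ → m ≤ normSq n₁ n₂)

-- Multiplying the first coordinate by f maps Λ_{q,b} into Λ_{q,fb}, and multiplying the second
-- by f maps Λ_{q,fb} into Λ_{q,b}; both keep nonzero vectors nonzero and stretch squared lengths
-- by at most f², so the two minima agree up to that factor. If b b̄ ≡ 1 mod q, swapping the
-- coordinates is an isometry between Λ_{q,b} and Λ_{q,b̄}, so their minima coincide.
module Submission where

open import Defs
open import Data.Nat using (ℕ; _≤_) renaming (_*_ to _*ℕ_)
open import Data.Integer using (ℤ; +_; _*_; _-_; 1ℤ; 0ℤ; ∣_∣)
open import Data.Integer.GCD using (gcd)
open import Data.Integer.Divisibility using (_∣_)
open import Data.Product using (_×_; Σ; _,_)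
open import Relation.Binary.PropositionalEquality
import Data.Nat as ℕ
import Data.Nat.Properties as ℕ
import Data.Integer as ℤ
import Data.Integer.Properties as ℤ
import Data.Integer.Divisibility.Signed as Signed
open import Data.Sum using (inj₁; inj₂)
open import Data.Integer.Solver using (module +-*-Solver)

record TransfersShortVectors (q : ℕ) (b b′ : ℤ) (C : ℕ) : Set where
  constructor transfers
  field
    transfer :
      ∀ n₁ n₂ → InΛ q b n₁ n₂ → NonZeroVec n₁ n₂ →
      Σ ℤ λ k₁ → Σ ℤ λ k₂ → InΛ q b′ k₁ k₂ × NonZeroVec k₁ k₂ × normSq k₁ k₂ ≤ C *ℕ normSq n₁ n₂

shortestSq-≤ : ∀ {q b b′ C m m′} → TransfersShortVectors q b b′ C →
               IsShortestSq q b m → IsShortestSq q b′ m′ → m′ ≤ C *ℕ m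
shortestSq-≤ {C = C} (transfers transfer) ((n₁ , n₂ , n∈Λ , n≢0 , ∣n∣²≡m) , _) (_ , minimal′)
  with transfer n₁ n₂ n∈Λ n≢0
... | k₁ , k₂ , k∈Λ′ , k≢0 , ∣k∣²≤ =
  ℕ.≤-trans (minimal′ k₁ k₂ k∈Λ′ k≢0) (subst (λ x → normSq k₁ k₂ ≤ C *ℕ x) ∣n∣²≡m ∣k∣²≤)

InΛ-*ˡ : ∀ q b k n₁ n₂ → InΛ q b n₁ n₂ → InΛ q (k * b) (k * n₁) n₂
InΛ-*ˡ q b k n₁ n₂ n∈Λ =
  subst (+ q ∣_) distrib (Signed.∣⇒∣ᵤ {+ q} (Signed.∣n⇒∣m*n k (Signed.∣ᵤ⇒∣ n∈Λ)))
  where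
  open +-*-Solver
  distrib : k * (n₁ ℤ.+ b * n₂) ≡ k * n₁ ℤ.+ (k * b) * n₂
  distrib = solve 4 (λ k b n₁ n₂ → k :* (n₁ :+ b :* n₂) := k :* n₁ :+ (k :* b) :* n₂)
                    refl k b n₁ n₂

InΛ-*ʳ : ∀ q b k n₁ n₂ → InΛ q (k * b) n₁ n₂ → InΛ q b n₁ (k * n₂)
InΛ-*ʳ q b k n₁ n₂ = subst (+ q ∣_) (cong (λ x → n₁ ℤ.+ x) reassoc)
  where
  open +-*-Solver
  reassoc : (k * b) * n₂ ≡ b * (k * n₂)
  reassoc = solve 3 (λ k b n₂ → (k :* b) :* n₂ := b :* (k :* n₂)) refl k b n₂

InΛ-swap : ∀ q b b̄ n₁ n₂ → + q ∣ b * b̄ - 1ℤ → InΛ q b n₁ n₂ → InΛ q b̄ n₂ n₁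
InΛ-swap q b b̄ n₁ n₂ q∣bb̄-1 n∈Λ =
  subst (+ q ∣_) combination
    (Signed.∣⇒∣ᵤ {+ q} (Signed.∣m∣n⇒∣m-n (Signed.∣n⇒∣m*n b̄ (Signed.∣ᵤ⇒∣ n∈Λ))
                                   (Signed.∣n⇒∣m*n n₂ (Signed.∣ᵤ⇒∣ q∣bb̄-1))))
  where
  open +-*-Solver
  combination : b̄ * (n₁ ℤ.+ b * n₂) - n₂ * (b * b̄ - 1ℤ) ≡ n₂ ℤ.+ b̄ * n₁
  combination = solve 4 (λ b b̄ n₁ n₂ → b̄ :* (n₁ :+ b :* n₂) :- n₂ :* (b :* b̄ :- con 1ℤ)
                                       := n₂ :+ b̄ :* n₁)
                        refl b b̄ n₁ n₂

NonZeroVec-swap : ∀ {n₁ n₂} → NonZeroVec n₁ n₂ → NonZeroVec n₂ n₁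
NonZeroVec-swap n≢0 (n₂≡0 , n₁≡0) = n≢0 (n₁≡0 , n₂≡0)

NonZeroVec-*ˡ : ∀ {k n₁ n₂} → k ≢ 0ℤ → NonZeroVec n₁ n₂ → NonZeroVec (k * n₁) n₂
NonZeroVec-*ˡ {k} k≢0 n≢0 (kn₁≡0 , n₂≡0) with ℤ.i*j≡0⇒i≡0∨j≡0 k kn₁≡0
... | inj₁ k≡0  = k≢0 k≡0
... | inj₂ n₁≡0 = n≢0 (n₁≡0 , n₂≡0)

normSq-comm : ∀ n₁ n₂ → normSq n₁ n₂ ≡ normSq n₂ n₁
normSq-comm n₁ n₂ = ℕ.+-comm (∣ n₁ ∣ *ℕ ∣ n₁ ∣) (∣ n₂ ∣ *ℕ ∣ n₂ ∣)

scaled-sumSq-≤ : ∀ {f} a c → 1 ≤ f →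
                 (f *ℕ a) *ℕ (f *ℕ a) ℕ.+ c *ℕ c ≤ (f *ℕ f) *ℕ (a *ℕ a ℕ.+ c *ℕ c)
scaled-sumSq-≤ {f} a c 1≤f = begin
  (f *ℕ a) *ℕ (f *ℕ a) ℕ.+ c *ℕ c                ≡⟨ cong (ℕ._+ c *ℕ c) (ℕ.[m*n]*[o*p]≡[m*o]*[n*p] f a f a) ⟩
  (f *ℕ f) *ℕ (a *ℕ a) ℕ.+ c *ℕ c                ≤⟨ ℕ.+-monoʳ-≤ ((f *ℕ f) *ℕ (a *ℕ a)) (ℕ.m≤n*m (c *ℕ c) (f *ℕ f)) ⟩
  (f *ℕ f) *ℕ (a *ℕ a) ℕ.+ (f *ℕ f) *ℕ (c *ℕ c) ≡⟨ ℕ.*-distribˡ-+ (f *ℕ f) (a *ℕ a) (c *ℕ c) ⟨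
  (f *ℕ f) *ℕ (a *ℕ a ℕ.+ c *ℕ c)                ∎
  where
  open ℕ.≤-Reasoning
  instance
    f²≢0 : ℕ.NonZero (f *ℕ f)
    f²≢0 = ℕ.>-nonZero (ℕ.*-mono-≤ 1≤f 1≤f)

normSq-*ˡ-≤ : ∀ k n₁ n₂ → k ≢ 0ℤ → normSq (k * n₁) n₂ ≤ (∣ k ∣ *ℕ ∣ k ∣) *ℕ normSq n₁ n₂
normSq-*ˡ-≤ k n₁ n₂ k≢0 rewrite ℤ.abs-* k n₁ =
  scaled-sumSq-≤ ∣ n₁ ∣ ∣ n₂ ∣ (ℕ.n≢0⇒n>0 (λ ∣k∣≡0 → k≢0 (ℤ.∣i∣≡0⇒i≡0 ∣k∣≡0)))

scale-transfers : ∀ q b k → k ≢ 0ℤ → TransfersShortVectors q b (k * b) (∣ k ∣ *ℕ ∣ k ∣)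
scale-transfers q b k k≢0 = transfers λ n₁ n₂ n∈Λ n≢0 →
  k * n₁ , n₂ , InΛ-*ˡ q b k n₁ n₂ n∈Λ , NonZeroVec-*ˡ k≢0 n≢0 , normSq-*ˡ-≤ k n₁ n₂ k≢0

unscale-transfers : ∀ q b k → k ≢ 0ℤ → TransfersShortVectors q (k * b) b (∣ k ∣ *ℕ ∣ k ∣)
unscale-transfers q b k k≢0 = transfers λ n₁ n₂ n∈Λ n≢0 →
  n₁ , k * n₂ , InΛ-*ʳ q b k n₁ n₂ n∈Λ , NonZeroVec-swap (NonZeroVec-*ˡ k≢0 (NonZeroVec-swap n≢0)) ,
  subst₂ _≤_ (normSq-comm (k * n₂) n₁) (cong ((∣ k ∣ *ℕ ∣ k ∣) *ℕ_) (normSq-comm n₂ n₁))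
         (normSq-*ˡ-≤ k n₂ n₁ k≢0)

swap-transfers : ∀ q b b̄ → + q ∣ b * b̄ - 1ℤ → TransfersShortVectors q b b̄ 1
swap-transfers q b b̄ q∣bb̄-1 = transfers λ n₁ n₂ n∈Λ n≢0 →
  n₂ , n₁ , InΛ-swap q b b̄ n₁ n₂ q∣bb̄-1 n∈Λ , NonZeroVec-swap n≢0 ,
  ℕ.≤-reflexive (trans (normSq-comm n₂ n₁) (sym (ℕ.*-identityˡ (normSq n₁ n₂))))

shortestSq-*-comparable : ∀ {q b m m′} k → k ≢ 0ℤ →
                          IsShortestSq q b m → IsShortestSq q (k * b) m′ →
                          m′ ≤ (∣ k ∣ *ℕ ∣ k ∣) *ℕ m × m ≤ (∣ k ∣ *ℕ ∣ k ∣) *ℕ m′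
shortestSq-*-comparable {q} {b} k k≢0 s s′ =
  shortestSq-≤ (scale-transfers q b k k≢0) s s′ ,
  shortestSq-≤ (unscale-transfers q b k k≢0) s′ s

shortestSq-inverse : ∀ {q b b̄ m m′} → + q ∣ b * b̄ - 1ℤ →
                     IsShortestSq q b m → IsShortestSq q b̄ m′ → m ≡ m′
shortestSq-inverse {q} {b} {b̄} {m} {m′} q∣bb̄-1 s s′ = ℕ.≤-antisym
  (subst (m ≤_) (ℕ.*-identityˡ m′) (shortestSq-≤ (swap-transfers q b̄ b q∣b̄b-1) s′ s))
  (subst (m′ ≤_) (ℕ.*-identityˡ m) (shortestSq-≤ (swap-transfers q b b̄ q∣bb̄-1) s s′))
  where
  q∣b̄b-1 : + q ∣ b̄ * b - 1ℤ
  q∣b̄b-1 = subst (λ x → + q ∣ x - 1ℤ) (ℤ.*-comm b b̄) q∣bb̄-1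

lemma2p3 : ((f : ℕ) → 1 ≤ f →
    Σ ℕ (λ C → 1 ≤ C ×
    ((q : ℕ) (b : ℤ) → 1 ≤ q → gcd b (+ q) ≡ 1ℤ →
    (m m′ : ℕ) → IsShortestSq q b m → IsShortestSq q ((+ f) * b) m′ →
    (m′ ≤ C *ℕ m) × (m ≤ C *ℕ m′))))
    ×
    ((q : ℕ) (b : ℤ) → 1 ≤ q → gcd b (+ q) ≡ 1ℤ →
    (b̄ : ℤ) → (+ q) ∣ (b * b̄ - 1ℤ) →
    (m m′ : ℕ) → IsShortestSq q b m → IsShortestSq q b̄ m′ → m ≡ m′)
lemma2p3 =
  (λ f 1≤f → f *ℕ f , ℕ.*-mono-≤ 1≤f 1≤f ,
     λ _ _ _ _ _ _ → shortestSq-*-comparable (+ f) λ f≡0 → ℕ.<⇒≢ 1≤f (sym (ℤ.+-injective f≡0))) ,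
  (λ _ b _ _ b̄ q∣bb̄-1 _ _ → shortestSq-inverse {b = b} {b̄ = b̄} q∣bb̄-1)
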